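{- Let $G$ and $H$ be connected bipartite graphs with $G\approx H$. Then $|\mathrm{Hom}(G,T)| = |\mathrm{Hom}(H,T)|$ for every tree $T$ of diameter at most $3$.
   Context: All graphs are finite, simple and undirected. $\mathrm{Hom}(G,H)$ is the set of homomorphisms from $G$ to $H$. A tree is a connected acyclic graph; the diameter is the maximum over pairs of distinct vertices of the length of a shortest path between them. For a vertex set $S$, $N(S)$ is the set of vertices adjacent to some vertex of $S$. Two connected bipartite graphs $G,H$ (with at least two vertices) are neighbourhood size equivalent, $G\approx H$, if there are bipartitions $(X^G,Y^G)$ of $G$ and $(X^H,Y^H)$ of $H$ with $|X^G|\le|Y^G|$, $|X^H|\le|Y^H|$, $|X^G|=|X^H|$, $|Y^G|=|Y^H|$, and a bijection $\eta$ from the power set of $X^G$ to the power set of $X^H$ such that for every $S\subseteq X^G$: $|\eta(S)|=|S|$ and $|N(\eta(S))| = |N(S)|$. -}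

module Defs where

open import Data.Nat using (ℕ; zero; suc; _≤_)
open import Data.Bool using (Bool; true; false; not; _∧_)
open import Data.Fin using (Fin; zero; suc; inject₁; fromℕ)
open import Data.Fin.Properties using (all?)
open import Data.Fin.Subset using (Subset; _⊆_; ∣_∣)
open import Data.Vec using (Vec; []; _∷_; lookup; tabulate)
open import Data.List using (List; [_]; map; concatMap; filter; length; allFin)
open import Data.Bool.ListAction using (any)
open import Data.Product using (Σ; ∃; _×_; _,_)
open import Relation.Nullary using (¬_; Dec; yes; no)
open import Data.Empty using (⊥)
open import Relation.Binary.PropositionalEquality using (_≡_; _≢_; refl)
open import Data.Bool.Properties using (_≟_)
open import Function.Definitions using (Injective)

record Graph : Set where
  field
    size   : ℕ
    adj    : Fin size → Fin size → Bool
    sym    : ∀ u v → adj u v ≡ adj v u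
    irrefl : ∀ u → adj u u ≡ false

open Graph public

Edge : (G : Graph) → Fin (size G) → Fin (size G) → Set
Edge G u v = adj G u v ≡ true

IsHom : (G T : Graph) → (Fin (size G) → Fin (size T)) → Set
IsHom G T f = ∀ u v → Edge G u v → Edge T (f u) (f v)

isHom? : (G T : Graph) (f : Fin (size G) → Fin (size T)) → Dec (IsHom G T f)
isHom? G T f = all? λ u → all? λ v → implies (adj G u v) (adj T (f u) (f v))
  where
  implies : (a b : Bool) → Dec (a ≡ true → b ≡ true)
  implies false b     = yes λ ()
  implies true  true  = yes λ _ → refl
  implies true  false = no λ h → lem (h refl)
    where
    lem : false ≡ true → ⊥
    lem ()

-- list of all vectors of length n over Fin m (i.e. all maps Fin n → Fin m,
-- each exactly once)
allVecs : (n m : ℕ) → List (Vec (Fin m) n)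
allVecs zero    m = [ [] ]
allVecs (suc n) m = concatMap (λ v → map (_∷ v) (allFin m)) (allVecs n m)

homCount : (G T : Graph) → ℕ
homCount G T = length (filter (λ v → isHom? G T (lookup v)) (allVecs (size G) (size T)))

data Walk (G : Graph) : ℕ → Fin (size G) → Fin (size G) → Set where
  here : ∀ {u} → Walk G zero u u
  step : ∀ {k u v w} → Edge G u v → Walk G k v w → Walk G (suc k) u w

Connected : Graph → Set
Connected G = ∀ u v → ∃ λ k → Walk G k u v

-- distance (= length of a shortest walk = length of a shortest path) ≤ d
DistLe : (G : Graph) → ℕ → Fin (size G) → Fin (size G) → Set
DistLe G d u v = ∃ λ k → k ≤ d × Walk G k u v

DiameterLe : Graph → ℕ → Set
DiameterLe G d = ∀ u v → u ≢ v → DistLe G d u v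

-- a cycle of length k+3: distinct vertices c₀,…,c_{k+2} with c_i ~ c_{i+1}
-- and c_{k+2} ~ c₀
HasCycle : Graph → Set
HasCycle G = Σ ℕ λ k → Σ (Fin (suc (suc (suc k))) → Fin (size G)) λ c →
  Injective _≡_ _≡_ c ×
  (∀ (i : Fin (suc (suc k))) → Edge G (c (inject₁ i)) (c (suc i))) ×
  Edge G (c (fromℕ (suc (suc k)))) (c zero)

Acyclic : Graph → Set
Acyclic G = ¬ HasCycle G

IsTree : Graph → Set
IsTree G = 1 ≤ size G × Connected G × Acyclic G

-- a bipartition given by a 2-colouring: X = {v | c v = true}, Y = {v | c v = false}
IsBipartition : (G : Graph) → (Fin (size G) → Bool) → Set
IsBipartition G c = ∀ u v → Edge G u v → c u ≢ c v

Bipartite : Graph → Set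
Bipartite G = Σ (Fin (size G) → Bool) (IsBipartition G)

partX : (G : Graph) → (Fin (size G) → Bool) → Subset (size G)
partX G c = tabulate c

partY : (G : Graph) → (Fin (size G) → Bool) → Subset (size G)
partY G c = tabulate (λ v → not (c v))

nbhd : (G : Graph) → Subset (size G) → Subset (size G)
nbhd G S = tabulate λ v → any (λ u → lookup S u ∧ adj G u v) (allFin (size G))

NSEquiv : Graph → Graph → Set
NSEquiv G H =
  Σ (Fin (size G) → Bool) λ cG → Σ (Fin (size H) → Bool) λ cH →
  IsBipartition G cG × IsBipartition H cH ×
  ∣ partX G cG ∣ ≤ ∣ partY G cG ∣ × ∣ partX H cH ∣ ≤ ∣ partY H cH ∣ ×
  ∣ partX G cG ∣ ≡ ∣ partX H cH ∣ × ∣ partY G cG ∣ ≡ ∣ partY H cH ∣ ×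
  Σ (Subset (size G) → Subset (size H)) λ η →
  Σ (Subset (size H) → Subset (size G)) λ ι →
    (∀ S → S ⊆ partX G cG → η S ⊆ partX H cH) ×
    (∀ S → S ⊆ partX H cH → ι S ⊆ partX G cG) ×
    (∀ S → S ⊆ partX G cG → ι (η S) ≡ S) ×
    (∀ S → S ⊆ partX H cH → η (ι S) ≡ S) ×
    (∀ S → S ⊆ partX G cG → ∣ η S ∣ ≡ ∣ S ∣) ×
    (∀ S → S ⊆ partX G cG → ∣ nbhd H (η S) ∣ ≡ ∣ nbhd G S ∣)

{-# OPTIONS --safe #-}

-- A tree of diameter at most 3 is a double star: it has an edge ab such that every other
-- vertex is a leaf at a or at b, so it is a blow-up of the path 0–1–2–3 (leaves at a ↦ 0,
-- a ↦ 1, b ↦ 2, leaves at b ↦ 3).  A homomorphism f from a connected bipartite G = (X, Y)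
-- into such a tree maps X wholly to the odd or wholly to the even vertices of the path.
-- In the first case let S = f⁻¹(3) ⊆ X; then f amounts to a free choice of images: S into
-- the leaves at b, X ∖ S to a, N(S) to b and Y ∖ N(S) to b or a leaf at a.  So |Hom(G, T)|
-- is a sum over S ⊆ X of monomials with exponents |S|, |X| − |S|, |N(S)|, |Y| − |N(S)|,
-- plus the same with a and b exchanged, and a bijection η witnessing G ≈ H preserves
-- every exponent.

module Submission where

open import Data.Bool using (Bool; true; false; not; _∧_)
open import Data.Bool.Properties using (¬-not; not-¬; not-injective; T-≡; ∧-conicalˡ; ∧-conicalʳ; ∧-identityʳ)
  renaming (_≟_ to _≟ᵇ_)
open import Data.Fin using (Fin; zero; suc; toℕ; inject₁; fromℕ; opposite)
open import Data.Fin.Patterns using (0F; 1F; 2F; 3F)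
open import Data.Fin.Properties using (_≟_; all?; any?)
open import Data.Fin.Subset using (Subset; inside; outside; _⊆_; ∣_∣)
open import Data.Fin.Subset.Properties using (_⊆?_)
open import Data.List as List using (List; []; _∷_; _++_; [_]; map; concatMap; filter; length; allFin; _ʳ++_)
open import Data.List.Membership.Propositional using (_∈_; _∉_; lose)
open import Data.List.Membership.Propositional.Properties using (∈-∃++; ∈-++⁺ʳ; ∈-lookup; ∈-allFin)
open import Data.List.Relation.Binary.Disjoint.Propositional using (Disjoint)
open import Data.List.Relation.Unary.All as All using ([]; _∷_)
open import Data.List.Relation.Unary.All.Properties using (¬Any⇒All¬; ++⁻ˡ)
open import Data.List.Relation.Unary.Any using (here; there; satisfied)
open import Data.List.Relation.Unary.Any.Properties using (any⁺; any⁻)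
open import Data.List.Relation.Unary.Unique.Propositional using (Unique; []; _∷_)
open import Data.List.Relation.Unary.Unique.Propositional.Properties using (Unique[x∷xs]⇒x∉xs)
open import Data.Nat using (ℕ; zero; suc; _+_; _*_; _^_; _∸_; _≤_; z≤n; s≤s; ∣_-_∣; _≡ᵇ_)
open import Data.Nat.Properties
  using ( +-assoc; +-identityʳ; *-identityˡ; *-identityʳ; *-zeroʳ; *-assoc; *-distribˡ-+; ^-identityʳ
        ; ^-distribˡ-+-*; m+n∸m≡n; ∣-∣-comm; ∣n-n∣≡0; m<n⇒m≤1+n; ≤-trans
        ; +-commutativeSemigroup; +-*-semiring; *-1-commutativeMonoid )
open import Data.Product using (Σ-syntax; ∃-syntax; _×_; _,_; proj₁; proj₂)
open import Data.Sum using (_⊎_; inj₁; inj₂)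
open import Data.Empty using (⊥)
open import Data.Unit using (⊤; tt)
open import Data.Vec using (Vec; []; _∷_; lookup; tabulate)
open import Data.Vec.Properties
  using (≡-dec; ∷-injective; lookup∘tabulate; tabulate∘lookup; tabulate-cong; lookup⇒[]=; []=⇒lookup)
open import Function using (_∘_; _⇔_; Equivalence; mk⇔; id)
open import Relation.Nullary using (Dec; yes; no; does; ¬_; _×-dec_; _⊎-dec_; ¬?; contradiction)
open import Relation.Nullary.Decidable using (from-yes; _→-dec_)
open import Relation.Binary.PropositionalEquality hiding ([_])
open import Defs hiding (sym)

open import Algebra.Properties.Semiring.Sum +-*-semiring
  using (sum-syntax; sum-cong-≗; ∑-distrib-+; *-distribʳ-sum)
open import Algebra.Properties.CommutativeMonoid.Sum *-1-commutativeMonoid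
  using () renaming (sum to ∏; sum-cong-≗ to ∏-cong; ∑-distrib-+ to ∏-distrib-*)
open import Algebra.Properties.CommutativeSemigroup +-commutativeSemigroup
  using () renaming (interchange to +-interchange)
open ≡-Reasoning

-- Indicators and finite sums

∏-syntax : ∀ n → (Fin n → ℕ) → ℕ
∏-syntax _ = ∏

infixl 10 ∏-syntax
syntax ∏-syntax n (λ i → x) = ∏[ i < n ] x

𝟙 : Bool → ℕ
𝟙 true  = 1
𝟙 false = 0

module _ {a b} {P : Set a} {Q : Set b} where

  𝟙-⇔ : (p : Dec P) (q : Dec Q) → P ⇔ Q → 𝟙 (does p) ≡ 𝟙 (does q)
  𝟙-⇔ (yes _) (yes _) _   = refl
  𝟙-⇔ (no _)  (no _)  _   = refl
  𝟙-⇔ (yes p) (no ¬q) P⇔Q = contradiction (Equivalence.to P⇔Q p) ¬q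
  𝟙-⇔ (no ¬p) (yes q) P⇔Q = contradiction (Equivalence.from P⇔Q q) ¬p

  𝟙-× : (p : Dec P) (q : Dec Q) → 𝟙 (does (p ×-dec q)) ≡ 𝟙 (does p) * 𝟙 (does q)
  𝟙-× (yes _) (yes _) = refl
  𝟙-× (yes _) (no _)  = refl
  𝟙-× (no _)  _       = refl

  𝟙-*-cong : ∀ (p : Dec P) (q : Dec Q) {m n} → P ⇔ Q → (P → m ≡ n) → 𝟙 (does p) * m ≡ 𝟙 (does q) * n
  𝟙-*-cong p q P⇔Q P⇒m≡n with p | q | 𝟙-⇔ p q P⇔Q
  ... | yes P | _ | 1≡𝟙q = trans (cong (1 *_) (P⇒m≡n P)) (cong (_* _) 1≡𝟙q)
  ... | no _  | _ | 0≡𝟙q = cong (_* _) 0≡𝟙q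

𝟙-partition : ∀ {h p q} {H : Set h} {P : Set p} {Q : Set q} (H? : Dec H) (P? : Dec P) (Q? : Dec Q) →
              (H → P ⊎ Q) → (P → ¬ Q) → 𝟙 (does H?) ≡ 𝟙 (does (H? ×-dec P?)) + 𝟙 (does (H? ×-dec Q?))
𝟙-partition (no _)  _        _        _     _        = refl
𝟙-partition (yes _) (yes P)  (yes Q)  _     disjoint = contradiction Q (disjoint P)
𝟙-partition (yes _) (yes _)  (no _)   _     _        = refl
𝟙-partition (yes _) (no _)   (yes _)  _     _        = refl
𝟙-partition (yes H) (no ¬P)  (no ¬Q)  cover _ with cover H
... | inj₁ P = contradiction P ¬P
... | inj₂ Q = contradiction Q ¬Q

𝟙-all : ∀ {n} {P : Fin n → Set} (P? : ∀ i → Dec (P i)) →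
        𝟙 (does (all? P?)) ≡ ∏[ i < n ] 𝟙 (does (P? i))
𝟙-all {zero}  P? = refl
𝟙-all {suc n} {P} P? = begin
  𝟙 (does (all? P?))                                ≡⟨ 𝟙-⇔ (all? P?) (P? zero ×-dec all? (P? ∘ suc)) split ⟩
  𝟙 (does (P? zero ×-dec all? (P? ∘ suc)))          ≡⟨ 𝟙-× (P? zero) (all? (P? ∘ suc)) ⟩
  𝟙 (does (P? zero)) * 𝟙 (does (all? (P? ∘ suc)))   ≡⟨ cong (𝟙 (does (P? zero)) *_) (𝟙-all (P? ∘ suc)) ⟩
  ∏[ i < suc n ] 𝟙 (does (P? i))                    ∎
  where
  split : (∀ i → P i) ⇔ (P zero × (∀ i → P (suc i)))
  split = mk⇔ (λ ∀P → ∀P zero , ∀P ∘ suc) λ { (P₀ , P₊) → λ { zero → P₀ ; (suc i) → P₊ i } }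

∏-^ : ∀ {n} x (e : Fin n → ℕ) → ∏[ v < n ] (x ^ e v) ≡ x ^ ∑[ v < n ] e v
∏-^ {zero}  x e = refl
∏-^ {suc n} x e = trans (cong (x ^ e zero *_) (∏-^ x (λ v → e (suc v)))) (sym (^-distribˡ-+-* x (e zero) _))

∣p∣≡∑𝟙 : ∀ {n} (S : Subset n) → ∣ S ∣ ≡ ∑[ v < n ] 𝟙 (lookup S v)
∣p∣≡∑𝟙 []          = refl
∣p∣≡∑𝟙 (true ∷ S)  = cong suc (∣p∣≡∑𝟙 S)
∣p∣≡∑𝟙 (false ∷ S) = ∣p∣≡∑𝟙 S

∣tabulate∣≡∑𝟙 : ∀ {n} (b : Fin n → Bool) → ∣ tabulate b ∣ ≡ ∑[ v < n ] 𝟙 (b v)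
∣tabulate∣≡∑𝟙 b = trans (∣p∣≡∑𝟙 (tabulate b)) (sum-cong-≗ (λ v → cong 𝟙 (lookup∘tabulate b v)))

∑-complement : ∀ {n} (a b : Fin n → Bool) → (∀ v → a v ≡ true → b v ≡ true) →
               ∑[ v < n ] 𝟙 (b v ∧ not (a v)) ≡ ∑[ v < n ] 𝟙 (b v) ∸ ∑[ v < n ] 𝟙 (a v)
∑-complement {n} a b a⇒b = begin
  ∑[ v < n ] 𝟙 (b v ∧ not (a v))                               ≡⟨ m+n∸m≡n (∑[ v < n ] 𝟙 (a v)) _ ⟨
  ∑[ v < n ] 𝟙 (a v) + ∑[ v < n ] 𝟙 (b v ∧ not (a v)) ∸ ∑[ v < n ] 𝟙 (a v)
    ≡⟨ cong (_∸ ∑[ v < n ] 𝟙 (a v)) (∑-distrib-+ (λ v → 𝟙 (a v)) (λ v → 𝟙 (b v ∧ not (a v)))) ⟨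
  ∑[ v < n ] (𝟙 (a v) + 𝟙 (b v ∧ not (a v))) ∸ ∑[ v < n ] 𝟙 (a v)
    ≡⟨ cong (_∸ ∑[ v < n ] 𝟙 (a v)) (sum-cong-≗ λ v → split (a v) (b v) (a⇒b v)) ⟩
  ∑[ v < n ] 𝟙 (b v) ∸ ∑[ v < n ] 𝟙 (a v) ∎
  where
  split : ∀ x y → (x ≡ true → y ≡ true) → 𝟙 x + 𝟙 (y ∧ not x) ≡ 𝟙 y
  split true  true  _   = refl
  split true  false x⇒y = contradiction (x⇒y refl) λ ()
  split false y     _   = cong 𝟙 (∧-identityʳ y)

∑ᴸ : ∀ {a} {A : Set a} → List A → (A → ℕ) → ℕ
∑ᴸ []       f = 0
∑ᴸ (x ∷ xs) f = f x + ∑ᴸ xs f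

infixl 10 ∑ᴸ
syntax ∑ᴸ xs (λ x → e) = ∑[ x ∈ xs ] e

module _ {a} {A : Set a} where

  ∑ᴸ-cong : ∀ (xs : List A) {f g : A → ℕ} → (∀ x → f x ≡ g x) → ∑ᴸ xs f ≡ ∑ᴸ xs g
  ∑ᴸ-cong []       f≗g = refl
  ∑ᴸ-cong (x ∷ xs) f≗g = cong₂ _+_ (f≗g x) (∑ᴸ-cong xs f≗g)

  ∑ᴸ-zero : ∀ (xs : List A) → ∑[ x ∈ xs ] 0 ≡ 0
  ∑ᴸ-zero []       = refl
  ∑ᴸ-zero (x ∷ xs) = ∑ᴸ-zero xs

  ∑ᴸ-distrib-+ : ∀ (xs : List A) (f g : A → ℕ) →
                 ∑[ x ∈ xs ] (f x + g x) ≡ ∑ᴸ xs f + ∑ᴸ xs g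
  ∑ᴸ-distrib-+ []       f g = refl
  ∑ᴸ-distrib-+ (x ∷ xs) f g =
    trans (cong (f x + g x +_) (∑ᴸ-distrib-+ xs f g)) (+-interchange (f x) (g x) _ _)

  *-distribˡ-∑ᴸ : ∀ k (xs : List A) (f : A → ℕ) → ∑[ x ∈ xs ] (k * f x) ≡ k * ∑ᴸ xs f
  *-distribˡ-∑ᴸ k []       f = sym (*-zeroʳ k)
  *-distribˡ-∑ᴸ k (x ∷ xs) f =
    trans (cong (k * f x +_) (*-distribˡ-∑ᴸ k xs f)) (sym (*-distribˡ-+ k (f x) _))

  ∑ᴸ-++ : ∀ (xs ys : List A) (f : A → ℕ) → ∑ᴸ (xs ++ ys) f ≡ ∑ᴸ xs f + ∑ᴸ ys f
  ∑ᴸ-++ []       ys f = refl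
  ∑ᴸ-++ (x ∷ xs) ys f = trans (cong (f x +_) (∑ᴸ-++ xs ys f)) (sym (+-assoc (f x) _ _))

  ∑ᴸ-tabulate : ∀ {n} (g : Fin n → A) (f : A → ℕ) → ∑ᴸ (List.tabulate g) f ≡ ∑[ i < n ] f (g i)
  ∑ᴸ-tabulate {zero}  g f = refl
  ∑ᴸ-tabulate {suc n} g f = cong (f (g zero) +_) (∑ᴸ-tabulate (λ i → g (suc i)) f)

  length-filter≡∑𝟙 : ∀ {p} {P : A → Set p} (P? : ∀ x → Dec (P x)) (xs : List A) →
                     length (filter P? xs) ≡ ∑[ x ∈ xs ] 𝟙 (does (P? x))
  length-filter≡∑𝟙 P? []       = refl
  length-filter≡∑𝟙 P? (x ∷ xs) with does (P? x)
  ... | true  = cong suc (length-filter≡∑𝟙 P? xs)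
  ... | false = length-filter≡∑𝟙 P? xs

module _ {a b} {A : Set a} {B : Set b} where

  ∑ᴸ-comm : ∀ (xs : List A) (ys : List B) (f : A → B → ℕ) →
            ∑[ x ∈ xs ] ∑[ y ∈ ys ] f x y ≡ ∑[ y ∈ ys ] ∑[ x ∈ xs ] f x y
  ∑ᴸ-comm []       ys f = sym (∑ᴸ-zero ys)
  ∑ᴸ-comm (x ∷ xs) ys f =
    trans (cong (∑ᴸ ys (f x) +_) (∑ᴸ-comm xs ys f)) (sym (∑ᴸ-distrib-+ ys (f x) _))

  ∑ᴸ-map : ∀ (g : A → B) (xs : List A) (f : B → ℕ) → ∑ᴸ (map g xs) f ≡ ∑[ x ∈ xs ] f (g x)
  ∑ᴸ-map g []       f = refl
  ∑ᴸ-map g (x ∷ xs) f = cong (f (g x) +_) (∑ᴸ-map g xs f)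

  ∑ᴸ-concatMap : ∀ (g : A → List B) (xs : List A) (f : B → ℕ) →
                 ∑ᴸ (concatMap g xs) f ≡ ∑[ x ∈ xs ] ∑ᴸ (g x) f
  ∑ᴸ-concatMap g []       f = refl
  ∑ᴸ-concatMap g (x ∷ xs) f =
    trans (∑ᴸ-++ (g x) (concatMap g xs) f) (cong (∑ᴸ (g x) f +_) (∑ᴸ-concatMap g xs f))

∑-allVecs-∏ : ∀ n m (g : Fin n → Fin m → ℕ) →
              ∑[ v ∈ allVecs n m ] ∏[ i < n ] g i (lookup v i) ≡ ∏[ i < n ] ∑[ t < m ] g i t
∑-allVecs-∏ zero    m g = refl
∑-allVecs-∏ (suc n) m g = begin
  ∑ᴸ (concatMap (λ v → map (_∷ v) (allFin m)) (allVecs n m)) Φ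
    ≡⟨ ∑ᴸ-concatMap (λ v → map (_∷ v) (allFin m)) (allVecs n m) Φ ⟩
  ∑[ v ∈ allVecs n m ] ∑ᴸ (map (_∷ v) (allFin m)) Φ
    ≡⟨ ∑ᴸ-cong (allVecs n m) prepend ⟩
  ∑[ v ∈ allVecs n m ] ∑[ t < m ] (g zero t * Ψ v)
    ≡⟨ ∑ᴸ-cong (allVecs n m) (λ v → sym (*-distribʳ-sum (Ψ v) (g zero))) ⟩
  ∑[ v ∈ allVecs n m ] (∑[ t < m ] g zero t * Ψ v)
    ≡⟨ *-distribˡ-∑ᴸ (∑[ t < m ] g zero t) (allVecs n m) Ψ ⟩
  ∑[ t < m ] g zero t * ∑ᴸ (allVecs n m) Ψ
    ≡⟨ cong (∑[ t < m ] g zero t *_) (∑-allVecs-∏ n m (λ i → g (suc i))) ⟩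
  ∏[ i < suc n ] ∑[ t < m ] g i t ∎
  where
  Φ : Vec (Fin m) (suc n) → ℕ
  Φ v = ∏[ i < suc n ] g i (lookup v i)
  Ψ : Vec (Fin m) n → ℕ
  Ψ v = ∏[ i < n ] g (suc i) (lookup v i)
  prepend : ∀ v → ∑ᴸ (map (_∷ v) (allFin m)) Φ ≡ ∑[ t < m ] (g zero t * Ψ v)
  prepend v = trans (∑ᴸ-map (_∷ v) (allFin m) Φ) (∑ᴸ-tabulate id (λ t → Φ (t ∷ v)))

subsets : ∀ n → List (Subset n)
subsets zero    = [ [] ]
subsets (suc n) = map (inside ∷_) (subsets n) ++ map (outside ∷_) (subsets n)

_≟ˢ_ : ∀ {n} (S S′ : Subset n) → Dec (S ≡ S′)
_≟ˢ_ = ≡-dec _≟ᵇ_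

∑-subsets-suc : ∀ {n} (F : Subset (suc n) → ℕ) →
                ∑ᴸ (subsets (suc n)) F
                ≡ ∑[ S ∈ subsets n ] F (inside ∷ S) + ∑[ S ∈ subsets n ] F (outside ∷ S)
∑-subsets-suc {n} F = trans (∑ᴸ-++ (map (inside ∷_) (subsets n)) _ F)
                            (cong₂ _+_ (∑ᴸ-map (inside ∷_) (subsets n) F) (∑ᴸ-map (outside ∷_) (subsets n) F))

∑-subsets-point : ∀ {n} (s : Subset n) (f : Subset n → ℕ) →
                  ∑[ S ∈ subsets n ] (𝟙 (does (S ≟ˢ s)) * f S) ≡ f s
∑-subsets-point []      f = trans (+-identityʳ _) (*-identityˡ (f []))
∑-subsets-point {suc n} (x ∷ s) f = begin
  ∑[ S ∈ subsets (suc n) ] (𝟙 (does (S ≟ˢ (x ∷ s))) * f S)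
    ≡⟨ ∑-subsets-suc (λ S → 𝟙 (does (S ≟ˢ (x ∷ s))) * f S) ⟩
  ∑[ S ∈ subsets n ] (𝟙 (does ((inside ∷ S) ≟ˢ (x ∷ s))) * f (inside ∷ S)) +
  ∑[ S ∈ subsets n ] (𝟙 (does ((outside ∷ S) ≟ˢ (x ∷ s))) * f (outside ∷ S))
    ≡⟨ cong₂ _+_ (restrict inside) (restrict outside) ⟩
  𝟙 (does (inside ≟ᵇ x)) * f (inside ∷ s) + 𝟙 (does (outside ≟ᵇ x)) * f (outside ∷ s)
    ≡⟨ select x ⟩
  f (x ∷ s) ∎
  where
  restrict : ∀ y → ∑[ S ∈ subsets n ] (𝟙 (does ((y ∷ S) ≟ˢ (x ∷ s))) * f (y ∷ S))
                   ≡ 𝟙 (does (y ≟ᵇ x)) * f (y ∷ s)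
  restrict y = begin
    ∑[ S ∈ subsets n ] (𝟙 (does ((y ∷ S) ≟ˢ (x ∷ s))) * f (y ∷ S))
      ≡⟨ ∑ᴸ-cong (subsets n) (λ S → cong (_* f (y ∷ S)) (𝟙-∷ S)) ⟩
    ∑[ S ∈ subsets n ] (𝟙 (does (y ≟ᵇ x)) * 𝟙 (does (S ≟ˢ s)) * f (y ∷ S))
      ≡⟨ ∑ᴸ-cong (subsets n) (λ S → *-assoc (𝟙 (does (y ≟ᵇ x))) _ _) ⟩
    ∑[ S ∈ subsets n ] (𝟙 (does (y ≟ᵇ x)) * (𝟙 (does (S ≟ˢ s)) * f (y ∷ S)))
      ≡⟨ *-distribˡ-∑ᴸ (𝟙 (does (y ≟ᵇ x))) (subsets n) _ ⟩
    𝟙 (does (y ≟ᵇ x)) * ∑[ S ∈ subsets n ] (𝟙 (does (S ≟ˢ s)) * f (y ∷ S))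
      ≡⟨ cong (𝟙 (does (y ≟ᵇ x)) *_) (∑-subsets-point s (λ S → f (y ∷ S))) ⟩
    𝟙 (does (y ≟ᵇ x)) * f (y ∷ s) ∎
    where
    𝟙-∷ : ∀ S → 𝟙 (does ((y ∷ S) ≟ˢ (x ∷ s))) ≡ 𝟙 (does (y ≟ᵇ x)) * 𝟙 (does (S ≟ˢ s))
    𝟙-∷ S = trans (𝟙-⇔ ((y ∷ S) ≟ˢ (x ∷ s)) ((y ≟ᵇ x) ×-dec (S ≟ˢ s))
                       (mk⇔ (λ eq → ∷-injective eq) (λ (y≡x , S≡s) → cong₂ _∷_ y≡x S≡s)))
                  (𝟙-× (y ≟ᵇ x) (S ≟ˢ s))

  select : ∀ x → 𝟙 (does (inside ≟ᵇ x)) * f (inside ∷ s) + 𝟙 (does (outside ≟ᵇ x)) * f (outside ∷ s)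
                 ≡ f (x ∷ s)
  select inside  = trans (+-identityʳ _) (*-identityˡ _)
  select outside = *-identityˡ _

module _ {n n′} {P : Subset n → Set} {P′ : Subset n′ → Set}
         (P? : ∀ S → Dec (P S)) (P′? : ∀ S′ → Dec (P′ S′))
         (η : Subset n → Subset n′) (ι : Subset n′ → Subset n)
         (η-P : ∀ S → P S → P′ (η S)) (ι-P : ∀ S′ → P′ S′ → P (ι S′))
         (ι∘η : ∀ S → P S → ι (η S) ≡ S) (η∘ι : ∀ S′ → P′ S′ → η (ι S′) ≡ S′) where

  ∑-subsets-reindex : (F : Subset n → ℕ) (F′ : Subset n′ → ℕ) → (∀ S → P S → F′ (η S) ≡ F S) →
                      ∑[ S ∈ subsets n ] (𝟙 (does (P? S)) * F S)
                      ≡ ∑[ S′ ∈ subsets n′ ] (𝟙 (does (P′? S′)) * F′ S′)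
  ∑-subsets-reindex F F′ F′∘η = begin
    ∑[ S ∈ subsets n ] (𝟙 (does (P? S)) * F S)
      ≡⟨ ∑ᴸ-cong (subsets n) (λ S → ∑-subsets-point (η S) _) ⟨
    ∑[ S ∈ subsets n ] ∑[ S′ ∈ subsets n′ ] (𝟙 (does (S′ ≟ˢ η S)) * (𝟙 (does (P? S)) * F S))
      ≡⟨ ∑ᴸ-cong (subsets n) (λ S → ∑ᴸ-cong (subsets n′) (λ S′ → swap S S′)) ⟩
    ∑[ S ∈ subsets n ] ∑[ S′ ∈ subsets n′ ] (𝟙 (does (S ≟ˢ ι S′)) * (𝟙 (does (P′? S′)) * F′ S′))
      ≡⟨ ∑ᴸ-comm (subsets n) (subsets n′) _ ⟩
    ∑[ S′ ∈ subsets n′ ] ∑[ S ∈ subsets n ] (𝟙 (does (S ≟ˢ ι S′)) * (𝟙 (does (P′? S′)) * F′ S′))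
      ≡⟨ ∑ᴸ-cong (subsets n′) (λ S′ → ∑-subsets-point (ι S′) _) ⟩
    ∑[ S′ ∈ subsets n′ ] (𝟙 (does (P′? S′)) * F′ S′) ∎
    where
    swap : ∀ S S′ → 𝟙 (does (S′ ≟ˢ η S)) * (𝟙 (does (P? S)) * F S)
                    ≡ 𝟙 (does (S ≟ˢ ι S′)) * (𝟙 (does (P′? S′)) * F′ S′)
    swap S S′ = begin
      𝟙 (does (S′ ≟ˢ η S)) * (𝟙 (does (P? S)) * F S)   ≡⟨ *-assoc (𝟙 (does (S′ ≟ˢ η S))) _ (F S) ⟨
      𝟙 (does (S′ ≟ˢ η S)) * 𝟙 (does (P? S)) * F S     ≡⟨ cong (_* F S) (𝟙-× (S′ ≟ˢ η S) (P? S)) ⟨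
      𝟙 (does ((S′ ≟ˢ η S) ×-dec P? S)) * F S
        ≡⟨ 𝟙-*-cong ((S′ ≟ˢ η S) ×-dec P? S) ((S ≟ˢ ι S′) ×-dec P′? S′) (mk⇔ forth back)
                    (λ (S′≡ηS , PS) → trans (sym (F′∘η S PS)) (cong F′ (sym S′≡ηS))) ⟩
      𝟙 (does ((S ≟ˢ ι S′) ×-dec P′? S′)) * F′ S′      ≡⟨ cong (_* F′ S′) (𝟙-× (S ≟ˢ ι S′) (P′? S′)) ⟩
      𝟙 (does (S ≟ˢ ι S′)) * 𝟙 (does (P′? S′)) * F′ S′ ≡⟨ *-assoc (𝟙 (does (S ≟ˢ ι S′))) _ (F′ S′) ⟩
      𝟙 (does (S ≟ˢ ι S′)) * (𝟙 (does (P′? S′)) * F′ S′) ∎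
      where
      forth : S′ ≡ η S × P S → S ≡ ι S′ × P′ S′
      forth (refl , PS) = sym (ι∘η S PS) , η-P S PS
      back : S ≡ ι S′ × P′ S′ → S′ ≡ η S × P S
      back (refl , P′S′) = sym (η∘ι S′ P′S′) , ι-P S′ P′S′

module _ {a} {A : Set a} where

  Unique-++⁻ : ∀ (ys : List A) {x zs} → Unique (ys ++ x ∷ zs) → Unique ys × x ∉ ys
  Unique-++⁻ []       _          = [] , λ ()
  Unique-++⁻ (y ∷ ys) (y≢ ∷ u) with Unique-++⁻ ys u
  ... | uys , x∉ys = ++⁻ˡ ys y≢ ∷ uys , λ { (here refl) → All.lookup y≢ (∈-++⁺ʳ ys (here refl)) refl
                                          ; (there x∈ys) → x∉ys x∈ys }

  Unique-ʳ++⁻ : ∀ (xs : List A) {ys} → Unique (xs ʳ++ ys) → Unique ys × Disjoint xs ys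
  Unique-ʳ++⁻ []       u = u , λ ()
  Unique-ʳ++⁻ (x ∷ xs) u with Unique-ʳ++⁻ xs u
  ... | ux∷ys@(_ ∷ uys) , disjoint = uys , λ
    { (here refl , x∈ys) → Unique[x∷xs]⇒x∉xs ux∷ys x∈ys
    ; (there z∈xs , z∈ys) → disjoint (z∈xs , there z∈ys) }

  Unique-lookup-injective : ∀ {l : List A} → Unique l → ∀ {i j} → List.lookup l i ≡ List.lookup l j → i ≡ j
  Unique-lookup-injective {_ ∷ _} _        {zero}  {zero}  _  = refl
  Unique-lookup-injective {_ ∷ _} (x≢ ∷ _) {zero}  {suc j} eq = contradiction eq (All.lookup x≢ (∈-lookup j))
  Unique-lookup-injective {_ ∷ _} (x≢ ∷ _) {suc i} {zero}  eq =
    contradiction (sym eq) (All.lookup x≢ (∈-lookup i))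
  Unique-lookup-injective {_ ∷ _} (_ ∷ u)  {suc i} {suc j} eq = cong suc (Unique-lookup-injective u eq)

-- Graphs, walks and trees of diameter at most 3

module _ (G : Graph) where

  edge-sym : ∀ {x y} → Edge G x y → Edge G y x
  edge-sym {x} {y} = trans (Graph.sym G y x)

  edge-irrefl : ∀ {x y} → Edge G x y → x ≢ y
  edge-irrefl {x} x~x refl with trans (sym (Graph.irrefl G x)) x~x
  ... | ()

  ¬edge : ∀ {x y} → ¬ Edge G x y → adj G x y ≡ false
  ¬edge = ¬-not

  ∈nbhd⁺ : ∀ {S u v} → lookup S u ≡ true → Edge G u v → lookup (nbhd G S) v ≡ true
  ∈nbhd⁺ {S} {u} {v} u∈S u~v = trans (lookup∘tabulate _ v)
    (Equivalence.to T-≡ (any⁺ _ (lose (∈-allFin u) (Equivalence.from T-≡ (cong₂ _∧_ u∈S u~v)))))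

  ∈nbhd⁻ : ∀ {S v} → lookup (nbhd G S) v ≡ true → ∃[ u ] lookup S u ≡ true × Edge G u v
  ∈nbhd⁻ {S} {v} v∈N
    with satisfied (any⁻ _ (allFin (size G)) (Equivalence.from T-≡ (trans (sym (lookup∘tabulate _ v)) v∈N)))
  ... | u , u∈S∧u~v with Equivalence.to T-≡ u∈S∧u~v
  ... | u∈S∧u~v′ = u , ∧-conicalˡ _ _ u∈S∧u~v′ , ∧-conicalʳ _ _ u∈S∧u~v′

path : ℕ → Graph
path n = record
  { size   = n
  ; adj    = λ i j → ∣ toℕ i - toℕ j ∣ ≡ᵇ 1
  ; sym    = λ i j → cong (_≡ᵇ 1) (∣-∣-comm (toℕ i) (toℕ j))
  ; irrefl = λ i → cong (_≡ᵇ 1) (∣n-n∣≡0 (toℕ i))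
  }

P₄ : Graph
P₄ = path 4

IsBlowup : (T P : Graph) → (Fin (size T) → Fin (size P)) → Set
IsBlowup T P τ = ∀ t t′ → adj T t t′ ≡ adj P (τ t) (τ t′)

module _ (T : Graph) where

  private
    V : Set
    V = Fin (size T)

  _≢head_ : V → List V → Set
  x ≢head []      = ⊤
  x ≢head (z ∷ _) = x ≢ z

  NBWalk : List V → Set
  NBWalk (x ∷ y ∷ r) = Edge T x y × x ≢head r × NBWalk (y ∷ r)
  NBWalk _           = ⊤

  nbWalk? : ∀ l → Dec (NBWalk l)
  nbWalk? []          = yes tt
  nbWalk? (x ∷ [])    = yes tt
  nbWalk? (x ∷ y ∷ r) = (adj T x y ≟ᵇ true) ×-dec ≢head? r ×-dec nbWalk? (y ∷ r)
    where
    ≢head? : ∀ r → Dec (x ≢head r)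
    ≢head? []      = yes tt
    ≢head? (z ∷ _) = ¬? (x ≟ z)

  nbWalk-tail : ∀ x xs → NBWalk (x ∷ xs) → NBWalk xs
  nbWalk-tail x []       _           = tt
  nbWalk-tail x (y ∷ xs) (_ , _ , w) = w

  nbWalk-truncate : ∀ l {x r} → NBWalk (l ++ x ∷ r) → NBWalk (l ++ [ x ])
  nbWalk-truncate []              _                 = tt
  nbWalk-truncate (a ∷ [])        (a~x , _ , _)     = a~x , tt , tt
  nbWalk-truncate (a ∷ b ∷ [])    (a~b , a≢x , w)   = a~b , a≢x , nbWalk-truncate (b ∷ []) w
  nbWalk-truncate (a ∷ b ∷ c ∷ l) (a~b , a≢c , w)   = a~b , a≢c , nbWalk-truncate (b ∷ c ∷ l) w

  HeadsDiffer : List V → List V → Set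
  HeadsDiffer []      _  = ⊤
  HeadsDiffer (a ∷ _) ys = a ≢head ys

  nbWalk-ʳ++ : ∀ {x} xs ys → NBWalk (x ∷ xs) → NBWalk (x ∷ ys) → HeadsDiffer xs ys → NBWalk (xs ʳ++ x ∷ ys)
  nbWalk-ʳ++ []       ys _                   wy _    = wy
  nbWalk-ʳ++ {x} (a ∷ as) ys (x~a , x≢as , wa) wy a≢ys =
    nbWalk-ʳ++ as (x ∷ ys) wa (edge-sym T x~a , a≢ys , wy) (flip as x≢as)
    where
    flip : ∀ as → x ≢head as → HeadsDiffer as (x ∷ ys)
    flip []      _   = tt
    flip (_ ∷ _) x≢c = ≢-sym x≢c

  endpoint : V → List V → V
  endpoint u []       = u
  endpoint u (x ∷ xs) = endpoint x xs

  endpoint-∈ : ∀ x y ys → endpoint x (y ∷ ys) ∈ y ∷ ys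
  endpoint-∈ x y []       = here refl
  endpoint-∈ x y (z ∷ ys) = there (endpoint-∈ y z ys)

  walk⇒nbWalk : ∀ {k u v} → Walk T k u v →
                ∃[ xs ] NBWalk (u ∷ xs) × endpoint u xs ≡ v × length xs ≤ k
  walk⇒nbWalk here = [] , tt , refl , z≤n
  walk⇒nbWalk (step {u = u} {v = x} u~x w) with walk⇒nbWalk w
  ... | [] , _ , end , _ = x ∷ [] , (u~x , tt , tt) , end , s≤s z≤n
  ... | y ∷ ys , nb , end , len with y ≟ u
  ...   | yes refl = ys , nbWalk-tail x (y ∷ ys) nb , end , m<n⇒m≤1+n len
  ...   | no y≢u   = x ∷ y ∷ ys , (u~x , ≢-sym y≢u , nb) , end , s≤s len

  lookup-last : ∀ a l → List.lookup (a ∷ l) (fromℕ (length l)) ≡ endpoint a l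
  lookup-last a []      = refl
  lookup-last a (b ∷ l) = lookup-last b l

  nbWalk-lookup : ∀ a l {r} → NBWalk ((a ∷ l) ++ r) →
                  ∀ i → Edge T (List.lookup (a ∷ l) (inject₁ i)) (List.lookup l i)
  nbWalk-lookup a (b ∷ l) (a~b , _ , _) zero    = a~b
  nbWalk-lookup a (b ∷ l) (_   , _ , w) (suc i) = nbWalk-lookup b l w i

  nbWalk-last : ∀ a l {x} → NBWalk ((a ∷ l) ++ [ x ]) → Edge T (endpoint a l) x
  nbWalk-last a []      (a~x , _) = a~x
  nbWalk-last a (b ∷ l) (_ , _ , w) = nbWalk-last b l w

  closed-nbWalk⇒cycle : ∀ {x y z} ys → Unique (x ∷ y ∷ z ∷ ys) → NBWalk (x ∷ y ∷ z ∷ ys ++ [ x ]) → HasCycle T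
  closed-nbWalk⇒cycle {x} {y} {z} ys unique walk =
    length ys , List.lookup (x ∷ y ∷ z ∷ ys) , Unique-lookup-injective unique ,
    nbWalk-lookup x (y ∷ z ∷ ys) walk ,
    subst (λ v → Edge T v x) (sym (lookup-last x (y ∷ z ∷ ys))) (nbWalk-last x (y ∷ z ∷ ys) walk)

  Dominating : V → V → Set
  Dominating a b = ∀ t → t ≡ a ⊎ t ≡ b ⊎ Edge T a t ⊎ Edge T b t

  NoNBWalk₃ : V → V → Set
  NoNBWalk₃ a b = ∀ {w w′} → ¬ NBWalk (a ∷ b ∷ w ∷ w′ ∷ [])

  module _ (connected : Connected T) where

    dominating-edge : ∀ {a b} → Edge T a b → NoNBWalk₃ a b → NoNBWalk₃ b a → Dominating a b
    dominating-edge {a} {b} a~b no-abww no-baww t with walk⇒nbWalk (proj₂ (connected a t))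
    ... | []         , _           , end , _ = inj₁ (sym end)
    ... | w ∷ []     , (a~w , _)   , end , _ = inj₂ (inj₂ (inj₁ (subst (Edge T a) end a~w)))
    ... | w ∷ w′ ∷ r , walk@(a~w , a≢w′ , w~w′ , _) , end , _ with w ≟ b
    ...   | no w≢b   = contradiction (edge-sym T a~b , ≢-sym w≢b , a~w , a≢w′ , w~w′ , tt , tt) no-baww
    ...   | yes refl = inj₂ (inj₂ (inj₂ (subst (Edge T b) end (b~endpoint r walk))))
      where
      b~endpoint : ∀ r → NBWalk (a ∷ b ∷ w′ ∷ r) → Edge T b (endpoint w′ r)
      b~endpoint []      (_ , _ , b~w′ , _) = b~w′
      b~endpoint (_ ∷ _) walk               = contradiction (nbWalk-truncate (a ∷ b ∷ w′ ∷ []) walk) no-abww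

  module _ (acyclic : Acyclic T) where

    no-closed-nbWalk : ∀ x ys → Unique (x ∷ ys) → ¬ NBWalk (x ∷ ys ++ [ x ])
    no-closed-nbWalk x []          _      (x~x , _)     = edge-irrefl T x~x refl
    no-closed-nbWalk x (y ∷ [])    _      (_ , x≢x , _) = x≢x refl
    no-closed-nbWalk x (y ∷ z ∷ ys) unique walk         = acyclic (closed-nbWalk⇒cycle ys unique walk)

    nbWalk⇒Unique : ∀ l → NBWalk l → Unique l
    nbWalk⇒Unique []       _    = []
    nbWalk⇒Unique (x ∷ xs) walk = ¬Any⇒All¬ xs (no-return xs walk unique-xs) ∷ unique-xs
      where
      unique-xs : Unique xs
      unique-xs = nbWalk⇒Unique xs (nbWalk-tail x xs walk)
      no-return : ∀ xs → NBWalk (x ∷ xs) → Unique xs → x ∉ xs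
      no-return xs walk unique-xs x∈xs with ∈-∃++ x∈xs
      ... | ys , zs , refl with Unique-++⁻ ys unique-xs
      ...   | unique-ys , x∉ys =
              no-closed-nbWalk x ys (¬Any⇒All¬ ys x∉ys ∷ unique-ys) (nbWalk-truncate (x ∷ ys) walk)

    no-triangle : ∀ {x y z} → Edge T x y → Edge T y z → Edge T z x → ⊥
    no-triangle x~y y~z z~x
      with nbWalk⇒Unique _ (x~y , ≢-sym (edge-irrefl T z~x) , y~z , ≢-sym (edge-irrefl T x~y) , z~x , tt , tt)
    ... | (_ ∷ _ ∷ x≢x ∷ []) ∷ _ = x≢x refl

    no-square : ∀ {x y z w} → Edge T x y → Edge T y z → Edge T z w → Edge T w x → x ≢ z → y ≢ w → ⊥
    no-square x~y y~z z~w w~x x≢z y≢w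
      with nbWalk⇒Unique _ (x~y , x≢z , y~z , y≢w , z~w , ≢-sym x≢z , w~x , tt , tt)
    ... | (_ ∷ _ ∷ _ ∷ x≢x ∷ []) ∷ _ = x≢x refl

    nbWalk-unique : ∀ u as bs → NBWalk (u ∷ as) → NBWalk (u ∷ bs) → endpoint u as ≡ endpoint u bs → as ≡ bs
    nbWalk-unique u []       []       _  _  _   = refl
    nbWalk-unique u []       (b ∷ bs) _  wb end =
      contradiction (subst (_∈ b ∷ bs) (sym end) (endpoint-∈ u b bs)) (Unique[x∷xs]⇒x∉xs (nbWalk⇒Unique _ wb))
    nbWalk-unique u (a ∷ as) []       wa _  end =
      contradiction (subst (_∈ a ∷ as) end (endpoint-∈ u a as)) (Unique[x∷xs]⇒x∉xs (nbWalk⇒Unique _ wa))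
    nbWalk-unique u (a ∷ as) (b ∷ bs) wa wb end with a ≟ b
    ... | yes refl = cong (a ∷_) (nbWalk-unique a as bs (nbWalk-tail u _ wa) (nbWalk-tail u _ wb) end)
    ... | no a≢b   = contradiction
      (endpoint-∈ u a as , there (subst (_∈ b ∷ bs) (sym end) (endpoint-∈ u b bs)))
      (proj₂ (Unique-ʳ++⁻ (a ∷ as) (nbWalk⇒Unique _ (nbWalk-ʳ++ (a ∷ as) (b ∷ bs) wa wb a≢b))))

    module _ (diameter≤3 : DiameterLe T 3) where

      no-nbWalk₄ : ∀ {x₀ x₁ x₂ x₃ x₄} → ¬ NBWalk (x₀ ∷ x₁ ∷ x₂ ∷ x₃ ∷ x₄ ∷ [])
      no-nbWalk₄ {x₀} {x₁} {x₂} {x₃} {x₄} walk with nbWalk⇒Unique _ walk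
      ... | (_ ∷ _ ∷ _ ∷ x₀≢x₄ ∷ []) ∷ _ with diameter≤3 x₀ x₄ x₀≢x₄
      ... | k , k≤3 , short with walk⇒nbWalk short
      ... | ws , walk′ , end , length≤k
            with nbWalk-unique x₀ (x₁ ∷ x₂ ∷ x₃ ∷ x₄ ∷ []) ws walk walk′ (sym end)
      ... | refl = contradiction (≤-trans length≤k k≤3) λ { (s≤s (s≤s (s≤s ()))) }

    module _ {a b} (a~b : Edge T a b) (dominating : Dominating a b) where

      data Position (t : V) : Fin 4 → Set where
        leaf-a   : t ≢ b → Edge T a t → Position t 0F
        centre-a : t ≡ a → Position t 1F
        centre-b : t ≡ b → Position t 2F
        leaf-b   : t ≢ a → adj T a t ≡ false → Edge T b t → Position t 3F

      position : V → Fin 4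
      position t with t ≟ a | t ≟ b | adj T a t
      ... | yes _ | _     | _     = 1F
      ... | no _  | yes _ | _     = 2F
      ... | no _  | no _  | true  = 0F
      ... | no _  | no _  | false = 3F

      position-view : ∀ t → Position t (position t)
      position-view t with t ≟ a | t ≟ b | adj T a t in a~t
      ... | yes t≡a | _       | _     = centre-a t≡a
      ... | no _    | yes t≡b | _     = centre-b t≡b
      ... | no _    | no t≢b  | true  = leaf-a t≢b a~t
      ... | no t≢a  | no t≢b  | false with dominating t
      ...   | inj₁ t≡a                = contradiction t≡a t≢a
      ...   | inj₂ (inj₁ t≡b)         = contradiction t≡b t≢b
      ...   | inj₂ (inj₂ (inj₁ a~t′)) = contradiction (trans (sym a~t) a~t′) λ ()
      ...   | inj₂ (inj₂ (inj₂ b~t))  = leaf-b t≢a a~t b~t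

      position-adj : ∀ {t t′ k k′} → Position t k → Position t′ k′ → adj T t t′ ≡ adj P₄ k k′
      position-adj (leaf-a _ a~t)     (leaf-a _ a~t′)      =
        ¬edge T λ t~t′ → no-triangle a~t t~t′ (edge-sym T a~t′)
      position-adj (leaf-a _ a~t)     (centre-a refl)      = edge-sym T a~t
      position-adj (leaf-a _ a~t)     (centre-b refl)      =
        ¬edge T λ t~b → no-triangle a~t t~b (edge-sym T a~b)
      position-adj (leaf-a t≢b a~t)   (leaf-b t′≢a _ b~t′) =
        ¬edge T λ t~t′ → no-square a~t t~t′ (edge-sym T b~t′) (edge-sym T a~b) (≢-sym t′≢a) t≢b
      position-adj (centre-a refl)    (leaf-a _ a~t′)      = a~t′
      position-adj (centre-a refl)    (centre-a refl)      = Graph.irrefl T a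
      position-adj (centre-a refl)    (centre-b refl)      = a~b
      position-adj (centre-a refl)    (leaf-b _ a≁t′ _)    = a≁t′
      position-adj (centre-b refl)    (leaf-a _ a~t′)      =
        ¬edge T λ b~t′ → no-triangle a~b b~t′ (edge-sym T a~t′)
      position-adj (centre-b refl)    (centre-a refl)      = edge-sym T a~b
      position-adj (centre-b refl)    (centre-b refl)      = Graph.irrefl T b
      position-adj (centre-b refl)    (leaf-b _ _ b~t′)    = b~t′
      position-adj (leaf-b t≢a _ b~t) (leaf-a t′≢b a~t′)   =
        ¬edge T λ t~t′ → no-square a~t′ (edge-sym T t~t′) (edge-sym T b~t) (edge-sym T a~b) (≢-sym t≢a) t′≢b
      position-adj (leaf-b _ a≁t _)   (centre-a refl)      = trans (Graph.sym T _ a) a≁t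
      position-adj (leaf-b _ _ b~t)   (centre-b refl)      = edge-sym T b~t
      position-adj (leaf-b _ _ b~t)   (leaf-b _ _ b~t′)    =
        ¬edge T λ t~t′ → no-triangle b~t t~t′ (edge-sym T b~t′)

      dominating-edge⇒P₄-blowup : Σ[ τ ∈ (V → Fin 4) ] IsBlowup T P₄ τ
      dominating-edge⇒P₄-blowup = position , λ t t′ → position-adj (position-view t) (position-view t′)

    diameter≤3⇒P₄-blowup : Connected T → DiameterLe T 3 → Σ[ τ ∈ (V → Fin 4) ] IsBlowup T P₄ τ
    -- The middle edge of a non-backtracking walk of length 3 dominates; without one, any edge does.
    diameter≤3⇒P₄-blowup connected diameter≤3 with any? (λ x → any? (λ y → adj T x y ≟ᵇ true))
    ... | no no-edge = (λ _ → 1F) , λ t t′ → ¬edge T λ t~t′ → no-edge (t , t′ , t~t′)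
    ... | yes (a , b , a~b)
          with any? (λ x₀ → any? (λ x₁ → any? (λ x₂ → any? (λ x₃ → nbWalk? (x₀ ∷ x₁ ∷ x₂ ∷ x₃ ∷ [])))))
    ...   | no no-nbWalk₃ =
            dominating-edge⇒P₄-blowup a~b
              (dominating-edge connected a~b (λ walk → no-nbWalk₃ (_ , _ , _ , _ , walk))
                                             (λ walk → no-nbWalk₃ (_ , _ , _ , _ , walk)))
    ...   | yes (x₀ , x₁ , x₂ , x₃ , (x₀~x₁ , x₀≢x₂ , x₁~x₂ , x₁≢x₃ , x₂~x₃ , _)) =
            dominating-edge⇒P₄-blowup x₁~x₂
              (dominating-edge connected x₁~x₂
                 (λ walk → no-nbWalk₄ diameter≤3 (x₀~x₁ , x₀≢x₂ , walk))
                 (λ walk → no-nbWalk₄ diameter≤3 (edge-sym T x₂~x₃ , ≢-sym x₁≢x₃ , walk)))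

-- Homomorphisms into blow-ups of P₄

data Region : Set where
  inS inX∖S inN inY∖N : Region

-- regionOf (v ∈ X) (v ∈ S) (v ∈ N(S)), for S ⊆ X and hence N(S) ⊆ Y.
regionOf : Bool → Bool → Bool → Region
regionOf true  true  _     = inS
regionOf true  false _     = inX∖S
regionOf false _     true  = inN
regionOf false _     false = inY∖N

-- The admissible images of each region when X goes to the odd vertices of P₄ and S = f⁻¹(3).
Allowed : Region → Fin 4 → Set
Allowed inS   k = k ≡ 3F
Allowed inX∖S k = k ≡ 1F
Allowed inN   k = k ≡ 2F
Allowed inY∖N k = k ≡ 0F ⊎ k ≡ 2F

allowed? : ∀ r k → Dec (Allowed r k)
allowed? inS   k = k ≟ 3F
allowed? inX∖S k = k ≟ 1F
allowed? inN   k = k ≟ 2F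
allowed? inY∖N k = k ≟ 0F ⊎-dec k ≟ 2F

odd : Fin 4 → Bool
odd 0F = false
odd 1F = true
odd 2F = false
odd 3F = true

odd-opposite : ∀ k → odd (opposite k) ≡ not (odd k)
odd-opposite 0F = refl
odd-opposite 1F = refl
odd-opposite 2F = refl
odd-opposite 3F = refl

P₄-edge-parity : ∀ k k′ → Edge P₄ k k′ → odd k ≡ not (odd k′)
P₄-edge-parity = from-yes (all? λ k → all? λ k′ → (adj P₄ k k′ ≟ᵇ true) →-dec (odd k ≟ᵇ not (odd k′)))

P₄-opposite : ∀ k k′ → adj P₄ (opposite k) (opposite k′) ≡ adj P₄ k k′
P₄-opposite = from-yes (all? λ k → all? λ k′ → adj P₄ (opposite k) (opposite k′) ≟ᵇ adj P₄ k k′)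

opposite-blowup : ∀ T (τ : Fin (size T) → Fin 4) → IsBlowup T P₄ τ → IsBlowup T P₄ (opposite ∘ τ)
opposite-blowup T τ blowup t t′ = trans (blowup t t′) (sym (P₄-opposite (τ t) (τ t′)))

neighbour-of-3 : ∀ (k : Fin 4) → Edge P₄ 3F k → k ≡ 2F
neighbour-of-3 0F ()
neighbour-of-3 1F ()
neighbour-of-3 2F _ = refl
neighbour-of-3 3F ()

≟3F⇒≡3F : ∀ (k : Fin 4) → does (k ≟ 3F) ≡ true → k ≡ 3F
≟3F⇒≡3F 0F ()
≟3F⇒≡3F 1F ()
≟3F⇒≡3F 2F ()
≟3F⇒≡3F 3F _ = refl

allowed-edgeˣʸ : ∀ s n s′ n′ {k k′} → (s ≡ true → n′ ≡ true) →
                 Allowed (regionOf true s n) k → Allowed (regionOf false s′ n′) k′ → Edge P₄ k k′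
allowed-edgeˣʸ true  _ _ true  _   refl refl        = refl
allowed-edgeˣʸ true  _ _ false s⇒n′ _   _           = contradiction (s⇒n′ refl) λ ()
allowed-edgeˣʸ false _ _ true  _   refl refl        = refl
allowed-edgeˣʸ false _ _ false _   refl (inj₁ refl) = refl
allowed-edgeˣʸ false _ _ false _   refl (inj₂ refl) = refl

allowed-edge : ∀ c s n c′ s′ n′ {k k′} → c ≢ c′ → (s ≡ true → n′ ≡ true) → (s′ ≡ true → n ≡ true) →
               Allowed (regionOf c s n) k → Allowed (regionOf c′ s′ n′) k′ → Edge P₄ k k′
allowed-edge true  s n true  s′ n′ c≢c′ _ _ _ _ = contradiction refl c≢c′
allowed-edge false s n false s′ n′ c≢c′ _ _ _ _ = contradiction refl c≢c′
allowed-edge true  s n false s′ n′ _ s⇒n′ _ a a′ = allowed-edgeˣʸ s n s′ n′ s⇒n′ a a′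
allowed-edge false s n true  s′ n′ {k} {k′} _ _ s′⇒n a a′ =
  trans (Graph.sym P₄ k k′) (allowed-edgeˣʸ s′ n′ s n s′⇒n a′ a)

allowed-parity : ∀ c s n {k} → Allowed (regionOf c s n) k → odd k ≡ c
allowed-parity true  true  _     refl        = refl
allowed-parity true  false _     refl        = refl
allowed-parity false _     true  refl        = refl
allowed-parity false _     false (inj₁ refl) = refl
allowed-parity false _     false (inj₂ refl) = refl

allowed-leaf : ∀ c s n {k} → (s ≡ true → c ≡ true) → Allowed (regionOf c s n) k → does (k ≟ 3F) ≡ s
allowed-leaf true  true  _     _   refl        = refl
allowed-leaf true  false _     _   refl        = refl
allowed-leaf false true  _     s⇒c _           = contradiction (s⇒c refl) λ ()
allowed-leaf false false true  _   refl        = refl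
allowed-leaf false false false _   (inj₁ refl) = refl
allowed-leaf false false false _   (inj₂ refl) = refl

parity-allowed : ∀ c n k → odd k ≡ c → (c ≡ false → n ≡ true → k ≡ 2F) →
                 Allowed (regionOf c (does (k ≟ 3F)) n) k
parity-allowed _ true  0F refl n⇒2 = contradiction (n⇒2 refl refl) λ ()
parity-allowed _ false 0F refl _   = inj₁ refl
parity-allowed _ _     1F refl _   = refl
parity-allowed _ true  2F refl _   = refl
parity-allowed _ false 2F refl _   = inj₂ refl
parity-allowed _ _     3F refl _   = refl

choices : ∀ {m} → (Fin m → Fin 4) → Region → ℕ
choices {m} τ r = ∑[ t < m ] 𝟙 (does (allowed? r (τ t)))

module _ (G : Graph) (c : Fin (size G) → Bool) where

  region : Subset (size G) → Fin (size G) → Region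
  region S v = regionOf (c v) (lookup S v) (lookup (nbhd G S) v)

  weight : (Region → ℕ) → Subset (size G) → ℕ
  weight κ S = ∏[ v < size G ] κ (region S v)

  weightSum : (Region → ℕ) → ℕ
  weightSum κ = ∑[ S ∈ subsets (size G) ] (𝟙 (does (S ⊆? partX G c)) * weight κ S)

module _ (G : Graph) (c : Fin (size G) → Bool) (bipartition : IsBipartition G c)
         {S : Subset (size G)} (S⊆X : S ⊆ partX G c) where

  ∈S⇒∈X : ∀ {v} → lookup S v ≡ true → c v ≡ true
  ∈S⇒∈X {v} v∈S = trans (sym (lookup∘tabulate c v)) ([]=⇒lookup (S⊆X (lookup⇒[]= v S v∈S)))

  ∈N⇒∈Y : ∀ {v} → lookup (nbhd G S) v ≡ true → c v ≡ false
  ∈N⇒∈Y v∈N with ∈nbhd⁻ G {S} v∈N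
  ... | u , u∈S , u~v = ¬-not λ cv≡true → bipartition u _ u~v (trans (∈S⇒∈X u∈S) (sym cv≡true))

module _ (G : Graph) (c : Fin (size G) → Bool) (bipartition : IsBipartition G c) (T : Graph) where

  private
    n m : ℕ
    n = size G
    m = size T
    X : Subset n
    X = partX G c

  Oriented : (Fin m → Fin 4) → (Fin n → Fin m) → Set
  Oriented τ f = ∀ v → odd (τ (f v)) ≡ c v

  oriented? : ∀ τ f → Dec (Oriented τ f)
  oriented? τ f = all? λ v → odd (τ (f v)) ≟ᵇ c v

  module _ (τ : Fin m → Fin 4) (blowup : IsBlowup T P₄ τ) where

    Fits : Subset n → (Fin n → Fin m) → Set
    Fits S f = ∀ v → Allowed (region G c S v) (τ (f v))

    fits? : ∀ S f → Dec (Fits S f)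
    fits? S f = all? λ v → allowed? (region G c S v) (τ (f v))

    leafPart : (Fin n → Fin m) → Subset n
    leafPart f = tabulate λ v → does (τ (f v) ≟ 3F)

    ∈leafPart : ∀ {f v} → lookup (leafPart f) v ≡ true → τ (f v) ≡ 3F
    ∈leafPart {f} {v} v∈leaf = ≟3F⇒≡3F _ (trans (sym (lookup∘tabulate _ v)) v∈leaf)

    hom-edge : ∀ {f} → IsHom G T f → ∀ {u v} → Edge G u v → Edge P₄ (τ (f u)) (τ (f v))
    hom-edge {f} hom {u} {v} u~v = trans (sym (blowup (f u) (f v))) (hom u v u~v)

    fits⇒hom : ∀ {S f} → S ⊆ X → Fits S f → IsHom G T f
    fits⇒hom {S} {f} S⊆X fits u v u~v = trans (blowup (f u) (f v))
      (allowed-edge (c u) _ _ (c v) _ _ (bipartition u v u~v)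
        (λ u∈S → ∈nbhd⁺ G {S} u∈S u~v) (λ v∈S → ∈nbhd⁺ G {S} v∈S (edge-sym G u~v)) (fits u) (fits v))

    fits⇒oriented : ∀ {S f} → Fits S f → Oriented τ f
    fits⇒oriented fits v = allowed-parity _ _ _ (fits v)

    fits⇒leafPart : ∀ {S f} → S ⊆ X → Fits S f → leafPart f ≡ S
    fits⇒leafPart {S} S⊆X fits = trans
      (tabulate-cong λ v → allowed-leaf (c v) (lookup S v) _ (∈S⇒∈X G c bipartition S⊆X) (fits v))
      (tabulate∘lookup S)

    leafPart⊆X : ∀ {f} → Oriented τ f → leafPart f ⊆ X
    leafPart⊆X {f} oriented {v} v∈leaf = lookup⇒[]= v X (begin
      lookup X v          ≡⟨ lookup∘tabulate c v ⟩
      c v                 ≡⟨ oriented v ⟨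
      odd (τ (f v))       ≡⟨ cong odd (∈leafPart {f} ([]=⇒lookup v∈leaf)) ⟩
      true                ∎)

    hom⇒fits : ∀ {f} → IsHom G T f → Oriented τ f → Fits (leafPart f) f
    hom⇒fits {f} hom oriented v =
      subst (λ s → Allowed (regionOf (c v) s (lookup (nbhd G (leafPart f)) v)) (τ (f v)))
            (sym (lookup∘tabulate _ v))
            (parity-allowed (c v) _ (τ (f v)) (oriented v) (λ _ → neighbour-is-2))
      where
      neighbour-is-2 : lookup (nbhd G (leafPart f)) v ≡ true → τ (f v) ≡ 2F
      neighbour-is-2 v∈N with ∈nbhd⁻ G {leafPart f} v∈N
      ... | u , u∈leaf , u~v =
            neighbour-of-3 _ (subst (λ k → Edge P₄ k (τ (f v))) (∈leafPart {f} u∈leaf) (hom-edge hom u~v))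

    fits⇔ : ∀ {S f} → (S ⊆ X × Fits S f) ⇔ (S ≡ leafPart f × (IsHom G T f × Oriented τ f))
    fits⇔ {S} = mk⇔
      (λ (S⊆X , fits) → sym (fits⇒leafPart S⊆X fits) , fits⇒hom S⊆X fits , fits⇒oriented {S} fits)
      (λ { (refl , hom , oriented) → leafPart⊆X oriented , hom⇒fits hom oriented })

    ∑-fits : ∀ f → ∑[ S ∈ subsets n ] (𝟙 (does (S ⊆? X)) * 𝟙 (does (fits? S f)))
                   ≡ 𝟙 (does (isHom? G T f ×-dec oriented? τ f))
    ∑-fits f = begin
      ∑[ S ∈ subsets n ] (𝟙 (does (S ⊆? X)) * 𝟙 (does (fits? S f)))
        ≡⟨ ∑ᴸ-cong (subsets n) unique-S ⟩
      ∑[ S ∈ subsets n ] (𝟙 (does (S ≟ˢ leafPart f)) * 𝟙 (does (isHom? G T f ×-dec oriented? τ f)))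
        ≡⟨ ∑-subsets-point (leafPart f) _ ⟩
      𝟙 (does (isHom? G T f ×-dec oriented? τ f)) ∎
      where
      unique-S : ∀ S → 𝟙 (does (S ⊆? X)) * 𝟙 (does (fits? S f))
                       ≡ 𝟙 (does (S ≟ˢ leafPart f)) * 𝟙 (does (isHom? G T f ×-dec oriented? τ f))
      unique-S S = begin
        𝟙 (does (S ⊆? X)) * 𝟙 (does (fits? S f))    ≡⟨ 𝟙-× (S ⊆? X) (fits? S f) ⟨
        𝟙 (does (S ⊆? X ×-dec fits? S f))
          ≡⟨ 𝟙-⇔ (S ⊆? X ×-dec fits? S f) (S ≟ˢ leafPart f ×-dec (isHom? G T f ×-dec oriented? τ f)) fits⇔ ⟩
        𝟙 (does (S ≟ˢ leafPart f ×-dec (isHom? G T f ×-dec oriented? τ f)))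
          ≡⟨ 𝟙-× (S ≟ˢ leafPart f) (isHom? G T f ×-dec oriented? τ f) ⟩
        𝟙 (does (S ≟ˢ leafPart f)) * 𝟙 (does (isHom? G T f ×-dec oriented? τ f)) ∎

    count-fits : ∀ S → ∑[ v ∈ allVecs n m ] 𝟙 (does (fits? S (lookup v))) ≡ weight G c (choices τ) S
    count-fits S = begin
      ∑[ v ∈ allVecs n m ] 𝟙 (does (fits? S (lookup v)))
        ≡⟨ ∑ᴸ-cong (allVecs n m) (λ v → 𝟙-all (λ i → allowed? (region G c S i) (τ (lookup v i)))) ⟩
      ∑[ v ∈ allVecs n m ] ∏[ i < n ] 𝟙 (does (allowed? (region G c S i) (τ (lookup v i))))
        ≡⟨ ∑-allVecs-∏ n m (λ i t → 𝟙 (does (allowed? (region G c S i) (τ t)))) ⟩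
      weight G c (choices τ) S ∎

    count-oriented-homs : ∑[ v ∈ allVecs n m ] 𝟙 (does (isHom? G T (lookup v) ×-dec oriented? τ (lookup v)))
                          ≡ weightSum G c (choices τ)
    count-oriented-homs = begin
      ∑[ v ∈ allVecs n m ] 𝟙 (does (isHom? G T (lookup v) ×-dec oriented? τ (lookup v)))
        ≡⟨ ∑ᴸ-cong (allVecs n m) (λ v → ∑-fits (lookup v)) ⟨
      ∑[ v ∈ allVecs n m ] ∑[ S ∈ subsets n ] (𝟙 (does (S ⊆? X)) * 𝟙 (does (fits? S (lookup v))))
        ≡⟨ ∑ᴸ-comm (allVecs n m) (subsets n) _ ⟩
      ∑[ S ∈ subsets n ] ∑[ v ∈ allVecs n m ] (𝟙 (does (S ⊆? X)) * 𝟙 (does (fits? S (lookup v))))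
        ≡⟨ ∑ᴸ-cong (subsets n) (λ S → *-distribˡ-∑ᴸ (𝟙 (does (S ⊆? X))) (allVecs n m) _) ⟩
      ∑[ S ∈ subsets n ] (𝟙 (does (S ⊆? X)) * ∑[ v ∈ allVecs n m ] 𝟙 (does (fits? S (lookup v))))
        ≡⟨ ∑ᴸ-cong (subsets n) (λ S → cong (𝟙 (does (S ⊆? X)) *_) (count-fits S)) ⟩
      weightSum G c (choices τ) ∎

    orientation-propagates : ∀ {f} → IsHom G T f → ∀ {k u v} → Walk G k u v →
                             odd (τ (f u)) ≡ c u → odd (τ (f v)) ≡ c v
    orientation-propagates hom here                          agrees = agrees
    orientation-propagates {f} hom (step {u = u} {v = w} u~w walk) agrees =
      orientation-propagates hom walk (not-injective (begin
        not (odd (τ (f w))) ≡⟨ P₄-edge-parity _ _ (hom-edge hom u~w) ⟨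
        odd (τ (f u))       ≡⟨ agrees ⟩
        c u                 ≡⟨ ¬-not (bipartition u w u~w) ⟩
        not (c w)           ∎))

  module _ (connected : Connected G) (v₀ : Fin n) (τ : Fin m → Fin 4) (blowup : IsBlowup T P₄ τ) where

    oriented-or-opposite : ∀ {f} → IsHom G T f → Oriented τ f ⊎ Oriented (opposite ∘ τ) f
    oriented-or-opposite {f} hom with odd (τ (f v₀)) ≟ᵇ c v₀
    ... | yes agrees    = inj₁ λ v → orientation-propagates τ blowup hom (proj₂ (connected v₀ v)) agrees
    ... | no disagrees = inj₂ λ v → orientation-propagates (opposite ∘ τ) (opposite-blowup T τ blowup) hom
                           (proj₂ (connected v₀ v)) (trans (odd-opposite _) (sym (¬-not (≢-sym disagrees))))

    ¬oriented-both : ∀ {f} → Oriented τ f → ¬ Oriented (opposite ∘ τ) f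
    ¬oriented-both {f} oriented oriented′ =
      not-¬ (sym (oriented v₀)) (trans (sym (oriented′ v₀)) (odd-opposite (τ (f v₀))))

    𝟙-hom-split : ∀ f → 𝟙 (does (isHom? G T f)) ≡ 𝟙 (does (isHom? G T f ×-dec oriented? τ f))
                                                 + 𝟙 (does (isHom? G T f ×-dec oriented? (opposite ∘ τ) f))
    𝟙-hom-split f = 𝟙-partition (isHom? G T f) (oriented? τ f) (oriented? (opposite ∘ τ) f)
                                oriented-or-opposite ¬oriented-both

    homCount-P₄-blowup : homCount G T ≡ weightSum G c (choices τ) + weightSum G c (choices (opposite ∘ τ))
    homCount-P₄-blowup = begin
      homCount G T
        ≡⟨ length-filter≡∑𝟙 (λ v → isHom? G T (lookup v)) (allVecs n m) ⟩
      ∑[ v ∈ allVecs n m ] 𝟙 (does (isHom? G T (lookup v)))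
        ≡⟨ ∑ᴸ-cong (allVecs n m) (λ v → 𝟙-hom-split (lookup v)) ⟩
      ∑[ v ∈ allVecs n m ] (𝟙 (does (isHom? G T (lookup v) ×-dec oriented? τ (lookup v)))
                          + 𝟙 (does (isHom? G T (lookup v) ×-dec oriented? (opposite ∘ τ) (lookup v))))
        ≡⟨ ∑ᴸ-distrib-+ (allVecs n m) _ _ ⟩
      ∑[ v ∈ allVecs n m ] 𝟙 (does (isHom? G T (lookup v) ×-dec oriented? τ (lookup v)))
        + ∑[ v ∈ allVecs n m ] 𝟙 (does (isHom? G T (lookup v) ×-dec oriented? (opposite ∘ τ) (lookup v)))
        ≡⟨ cong₂ _+_ (count-oriented-homs τ blowup)
                     (count-oriented-homs (opposite ∘ τ) (opposite-blowup T τ blowup)) ⟩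
      weightSum G c (choices τ) + weightSum G c (choices (opposite ∘ τ)) ∎

-- Invariance under neighbourhood size equivalence

module _ (κ : Region → ℕ) where

  κ-regionOf : ∀ c s n → (s ≡ true → c ≡ true) → (n ≡ true → c ≡ false) →
               κ (regionOf c s n)
               ≡ κ inS ^ 𝟙 s * κ inX∖S ^ 𝟙 (c ∧ not s) * κ inN ^ 𝟙 n * κ inY∖N ^ 𝟙 (not c ∧ not n)
  κ-regionOf true  true  false _   _   =
    sym (trans (*-identityʳ _) (trans (*-identityʳ _) (trans (*-identityʳ _) (^-identityʳ _))))
  κ-regionOf true  false false _   _   =
    sym (trans (*-identityʳ _) (trans (*-identityʳ _) (trans (*-identityˡ _) (^-identityʳ _))))
  κ-regionOf false false true  _   _   = sym (trans (*-identityʳ _) (trans (*-identityˡ _) (^-identityʳ _)))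
  κ-regionOf false false false _   _   = sym (trans (*-identityˡ _) (^-identityʳ _))
  κ-regionOf true  _     true  _   n⇒¬c = contradiction (n⇒¬c refl) λ ()
  κ-regionOf false true  _     s⇒c _   = contradiction (s⇒c refl) λ ()

monomial : (Region → ℕ) → (s x t y : ℕ) → ℕ
monomial κ s x t y = κ inS ^ s * κ inX∖S ^ (x ∸ s) * κ inN ^ t * κ inY∖N ^ (y ∸ t)

module _ (G : Graph) (c : Fin (size G) → Bool) (bipartition : IsBipartition G c)
         {S : Subset (size G)} (S⊆X : S ⊆ partX G c) where

  private
    n : ℕ
    n = size G
    N : Subset n
    N = nbhd G S

  weight-formula : ∀ κ → weight G c κ S ≡ monomial κ (∣ S ∣) (∣ partX G c ∣) (∣ N ∣) (∣ partY G c ∣)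
  weight-formula κ = begin
    ∏[ v < n ] κ (region G c S v)
      ≡⟨ ∏-cong (λ v → κ-regionOf κ (c v) (lookup S v) (lookup N v)
                                  (∈S⇒∈X G c bipartition S⊆X) (∈N⇒∈Y G c bipartition S⊆X)) ⟩
    ∏[ v < n ] (a v * b v * d v * e v)
      ≡⟨ trans (∏-distrib-* _ e) (cong (_* ∏ e) (trans (∏-distrib-* _ d) (cong (_* ∏ d) (∏-distrib-* a b)))) ⟩
    ∏ a * ∏ b * ∏ d * ∏ e
      ≡⟨ cong₂ _*_ (cong₂ _*_ (cong₂ _*_ (∏-^ (κ inS) (λ v → 𝟙 (lookup S v)))
                                          (∏-^ (κ inX∖S) (λ v → 𝟙 (c v ∧ not (lookup S v)))))
                              (∏-^ (κ inN) (λ v → 𝟙 (lookup N v))))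
                   (∏-^ (κ inY∖N) (λ v → 𝟙 (not (c v) ∧ not (lookup N v)))) ⟩
    κ inS ^ ∑[ v < n ] 𝟙 (lookup S v) * κ inX∖S ^ ∑[ v < n ] 𝟙 (c v ∧ not (lookup S v))
      * κ inN ^ ∑[ v < n ] 𝟙 (lookup N v) * κ inY∖N ^ ∑[ v < n ] 𝟙 (not (c v) ∧ not (lookup N v))
      ≡⟨ cong₂ _*_ (cong₂ _*_ (cong₂ _*_ (cong (κ inS ^_) ∣S∣) (cong (κ inX∖S ^_) ∣X∖S∣))
                              (cong (κ inN ^_) ∣N∣))
                   (cong (κ inY∖N ^_) ∣Y∖N∣) ⟩
    κ inS ^ ∣ S ∣ * κ inX∖S ^ (∣ partX G c ∣ ∸ ∣ S ∣) * κ inN ^ ∣ N ∣ * κ inY∖N ^ (∣ partY G c ∣ ∸ ∣ N ∣) ∎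
    where
    a b d e : Fin n → ℕ
    a v = κ inS ^ 𝟙 (lookup S v)
    b v = κ inX∖S ^ 𝟙 (c v ∧ not (lookup S v))
    d v = κ inN ^ 𝟙 (lookup N v)
    e v = κ inY∖N ^ 𝟙 (not (c v) ∧ not (lookup N v))

    ∣S∣ : ∑[ v < n ] 𝟙 (lookup S v) ≡ ∣ S ∣
    ∣S∣ = sym (∣p∣≡∑𝟙 S)

    ∣N∣ : ∑[ v < n ] 𝟙 (lookup N v) ≡ ∣ N ∣
    ∣N∣ = sym (∣p∣≡∑𝟙 N)

    ∣X∖S∣ : ∑[ v < n ] 𝟙 (c v ∧ not (lookup S v)) ≡ ∣ partX G c ∣ ∸ ∣ S ∣
    ∣X∖S∣ = trans (∑-complement (lookup S) c (λ _ → ∈S⇒∈X G c bipartition S⊆X))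
                  (cong₂ _∸_ (sym (∣tabulate∣≡∑𝟙 c)) ∣S∣)

    ∣Y∖N∣ : ∑[ v < n ] 𝟙 (not (c v) ∧ not (lookup N v)) ≡ ∣ partY G c ∣ ∸ ∣ N ∣
    ∣Y∖N∣ = trans (∑-complement (lookup N) (λ v → not (c v))
                                (λ _ v∈N → cong not (∈N⇒∈Y G c bipartition S⊆X v∈N)))
                  (cong₂ _∸_ (sym (∣tabulate∣≡∑𝟙 (λ v → not (c v)))) ∣N∣)

weightSum-invariant : ∀ G H (e : NSEquiv G H) (κ : Region → ℕ) →
                      weightSum G (proj₁ e) κ ≡ weightSum H (proj₁ (proj₂ e)) κ
weightSum-invariant G H
  (cG , cH , bipG , bipH , _ , _ , ∣X∣ , ∣Y∣ , η , ι , η⊆ , ι⊆ , ι∘η , η∘ι , ∣ηS∣ , ∣NηS∣) κ =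
  ∑-subsets-reindex (_⊆? partX G cG) (_⊆? partX H cH) η ι η⊆ ι⊆ ι∘η η∘ι
                    (weight G cG κ) (weight H cH κ) same-weight
  where
  same-weight : ∀ S → S ⊆ partX G cG → weight H cH κ (η S) ≡ weight G cG κ S
  same-weight S S⊆X = begin
    weight H cH κ (η S)
      ≡⟨ weight-formula H cH bipH (η⊆ S S⊆X) κ ⟩
    monomial κ (∣ η S ∣) (∣ partX H cH ∣) (∣ nbhd H (η S) ∣) (∣ partY H cH ∣)
      ≡⟨ cong₂ (λ s t → monomial κ s (∣ partX H cH ∣) t (∣ partY H cH ∣)) (∣ηS∣ S S⊆X) (∣NηS∣ S S⊆X) ⟩
    monomial κ (∣ S ∣) (∣ partX H cH ∣) (∣ nbhd G S ∣) (∣ partY H cH ∣)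
      ≡⟨ cong₂ (λ x y → monomial κ (∣ S ∣) x (∣ nbhd G S ∣) y) (sym ∣X∣) (sym ∣Y∣) ⟩
    monomial κ (∣ S ∣) (∣ partX G cG ∣) (∣ nbhd G S ∣) (∣ partY G cG ∣)
      ≡⟨ weight-formula G cG bipG S⊆X κ ⟨
    weight G cG κ S ∎

theorem12 : (G H : Graph) →
    2 ≤ size G → 2 ≤ size H →
    Connected G → Connected H → Bipartite G → Bipartite H →
    NSEquiv G H →
    (T : Graph) → IsTree T → DiameterLe T 3 →
    homCount G T ≡ homCount H T
theorem12 G H 2≤∣G∣ 2≤∣H∣ connectedG connectedH _ _ G≈H@(cG , cH , bipG , bipH , _)
          T (_ , connectedT , acyclic) diameter≤3
  with diameter≤3⇒P₄-blowup T acyclic connectedT diameter≤3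
... | τ , blowup = begin
  homCount G T
    ≡⟨ homCount-P₄-blowup G cG bipG T connectedG (vertex 2≤∣G∣) τ blowup ⟩
  weightSum G cG (choices τ) + weightSum G cG (choices (opposite ∘ τ))
    ≡⟨ cong₂ _+_ (weightSum-invariant G H G≈H (choices τ))
                 (weightSum-invariant G H G≈H (choices (opposite ∘ τ))) ⟩
  weightSum H cH (choices τ) + weightSum H cH (choices (opposite ∘ τ))
    ≡⟨ homCount-P₄-blowup H cH bipH T connectedH (vertex 2≤∣H∣) τ blowup ⟨
  homCount H T ∎
  where
  vertex : ∀ {n} → 2 ≤ n → Fin n
  vertex (s≤s _) = zero
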